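{- Let $f$ be an $(n,m,S)$ zero-difference function from a finite abelian group $(A,+)$ onto a finite abelian group $(B,+)$, let $\lambda=\max_{x\in S}x$ and $\mu=\min_{x\in S}x$, and let $r_b=|f^{ -1}(b)|$ for $b\in B$. Then for each $b\in B$, $$\frac{n-\sqrt{\Delta}}{m}\le r_b\le\frac{n+\sqrt{\Delta}}{m},$$ where $\Delta=(n+\lambda n-\lambda)m^2-(n^2+n+\mu n-\mu)m+n^2$.
   Context: $\lambda_\alpha=|\{x\in A\mid f(x+\alpha)=f(x)\}|$ for $\alpha\in A\setminus\{0\}$; $f$ is an $(n,m,S)$ zero-difference function if $n=|A|$, $m=|f(A)|$ and $S=\{\lambda_\alpha\mid\alpha\in A\setminus\{0\}\}$. -}

module Defs where

open import Level using (Level; _⊔_)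
open import Algebra.Bundles using (AbelianGroup)
open import Data.List using (List; length; filter)
open import Data.List.Relation.Unary.Any using (Any)
import Data.List.Relation.Unary.Unique.Setoid as UniqueS
open import Data.Nat using (ℕ; _≤_)
open import Data.Product using (Σ; _×_; ∃)
open import Relation.Binary.Definitions using (Decidable)
open import Relation.Nullary using (¬_)
open import Data.Integer as ℤ using (ℤ; +_)
open import Relation.Binary.PropositionalEquality using (_≡_)

record FiniteAbelianGroup (c ℓ : Level) : Set (Level.suc (c ⊔ ℓ)) where
  field
    abGroup  : AbelianGroup c ℓ
  open AbelianGroup abGroup public
  field
    _≟_      : Decidable _≈_
    elems    : List Carrier
    complete : ∀ x → Any (x ≈_) elems
    unique   : UniqueS.Unique setoid elems

  order : ℕ
  order = length elems

open FiniteAbelianGroup using (Carrier)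

module _ {a ℓa b ℓb} (A : FiniteAbelianGroup a ℓa) (B : FiniteAbelianGroup b ℓb)
         (f : Carrier A → Carrier B) where
  private
    module A = FiniteAbelianGroup A
    module B = FiniteAbelianGroup B

  Congruent : Set _
  Congruent = ∀ {x y} → x A.≈ y → f x B.≈ f y

  Surjective : Set _
  Surjective = ∀ y → ∃ λ x → f x B.≈ y

  lambdaOf : Carrier A → ℕ
  lambdaOf α = length (filter (λ x → f (x A.∙ α) B.≟ f x) A.elems)

  fiber : Carrier B → ℕ
  fiber y = length (filter (λ x → f x B.≟ y) A.elems)

  -- lam = max S, where S = {λ_α | α ∈ A ∖ {0}}
  IsMaxS : ℕ → Set _
  IsMaxS lam = (Σ (Carrier A) λ α → ¬ (α A.≈ A.ε) × lambdaOf α ≡ lam)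
             × (∀ α → ¬ (α A.≈ A.ε) → lambdaOf α ≤ lam)

  IsMinS : ℕ → Set _
  IsMinS mu = (Σ (Carrier A) λ α → ¬ (α A.≈ A.ε) × lambdaOf α ≡ mu)
            × (∀ α → ¬ (α A.≈ A.ε) → mu ≤ lambdaOf α)

Δ : (n m lam mu : ℕ) → ℤ
Δ n m lam mu =
  ((+ n) ℤ.+ (+ lam) ℤ.* (+ n) ℤ.- (+ lam)) ℤ.* (+ m) ℤ.* (+ m)
  ℤ.- ((+ n) ℤ.* (+ n) ℤ.+ (+ n) ℤ.+ (+ mu) ℤ.* (+ n) ℤ.- (+ mu)) ℤ.* (+ m)
  ℤ.+ (+ n) ℤ.* (+ n)

module Submission where

-- Counting A gives Σ_b r_b = n, and counting the pairs (x, x + α) with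
-- f(x + α) = f(x) in two ways gives Σ_b r_b² = Σ_α λ_α ≤ n + (n − 1)λ, since translation by x
-- permutes A and λ_0 ≤ n.  Fix y, put T = n − r_y, S = Σ_{b ≠ y} r_b² and k = m − 1; Cauchy–Schwarz
-- over the other k fibres gives T² ≤ kS, and
--   Δ − (m r_y − n)² = m (k (n + nλ − r_y² − S − λ) + (λ − μ)(n − 1) + (kS − T²))
-- is a sum of nonnegative terms.

open import Defs
open import Level using (Level)
open import Data.Nat using (ℕ)
open import Data.Integer as ℤ using (ℤ; +_)

open import Data.Nat using (suc; _+_; _*_; _≤_; z≤n; s≤s)
open import Data.Nat.Properties
  using (≤-total; ≤-reflexive; m≤m+n; +-mono-≤; +-monoˡ-≤; +-monoʳ-≤; +-identityʳ; *-identityˡ; *-identityʳ;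
         *-zeroʳ; *-comm; +-comm; +-assoc; *-distribʳ-+; +-commutativeSemigroup; m≤n⇒∃[o]m+o≡n; module ≤-Reasoning)
open import Data.Nat.Tactic.RingSolver using (solve)
open import Data.Integer using (0ℤ; 1ℤ)
import Data.Integer.Properties as ℤₚ
import Data.Integer.Tactic.RingSolver as ℤSolver
open import Data.List using (List; []; _∷_; length; filter)
open import Data.List.Properties using (filter-all; filter-≐; length-filter)
open import Data.List.Relation.Unary.All as All using (All)
open import Data.List.Relation.Unary.All.Properties using (all-filter; All¬⇒¬Any)
open import Data.List.Relation.Unary.Any as Any using (Any; here; there)
import Data.List.Relation.Unary.AllPairs as AllPairs
import Data.List.Relation.Unary.Unique.Setoid as UniqueS
open import Data.Product using (_,_)
open import Data.Sum using (inj₁; inj₂)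
open import Function using (_∘_)
open import Relation.Binary using (Setoid; Decidable; _Preserves_⟶_)
open import Relation.Binary.PropositionalEquality
  using (_≡_; refl; sym; trans; cong; cong₂; subst; subst₂; module ≡-Reasoning)
open import Relation.Nullary using (Dec; yes; no; ¬_; ¬?; contradiction)
import Algebra.Properties.Group as GroupProperties
open import Algebra.Properties.CommutativeSemigroup +-commutativeSemigroup
  using () renaming (interchange to +-interchange; x∙yz≈y∙xz to +-left-comm)

∑ : ∀ {a} {X : Set a} → List X → (X → ℕ) → ℕ
∑ []       g = 0
∑ (x ∷ xs) g = g x + ∑ xs g

infix 5 ∑
syntax ∑ xs (λ x → e) = ∑[ x ∈ xs ] e

𝟙 : ∀ {p} {P : Set p} → Dec P → ℕ
𝟙 (yes _) = 1
𝟙 (no _)  = 0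

𝟙-cong : ∀ {p q} {P : Set p} {Q : Set q} → (P → Q) → (Q → P) → (p? : Dec P) (q? : Dec Q) → 𝟙 p? ≡ 𝟙 q?
𝟙-cong _   _   (yes _) (yes _) = refl
𝟙-cong p⇒q _   (yes p) (no ¬q) = contradiction (p⇒q p) ¬q
𝟙-cong _   q⇒p (no ¬p) (yes q) = contradiction (q⇒p q) ¬p
𝟙-cong _   _   (no _)  (no _)  = refl

module _ {ℓ} {X : Set ℓ} where

  ∑-cong : ∀ xs {g h : X → ℕ} → (∀ x → g x ≡ h x) → ∑ xs g ≡ ∑ xs h
  ∑-cong []       g≗h = refl
  ∑-cong (x ∷ xs) g≗h = cong₂ _+_ (g≗h x) (∑-cong xs g≗h)

  ∑-+ : ∀ xs (g h : X → ℕ) → ∑[ x ∈ xs ] g x + h x ≡ ∑ xs g + ∑ xs h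
  ∑-+ []       g h = refl
  ∑-+ (x ∷ xs) g h = trans (cong (λ t → g x + h x + t) (∑-+ xs g h)) (+-interchange (g x) (h x) _ _)

  ∑-*ʳ : ∀ xs (g : X → ℕ) c → ∑[ x ∈ xs ] g x * c ≡ ∑ xs g * c
  ∑-*ʳ []       g c = refl
  ∑-*ʳ (x ∷ xs) g c = trans (cong (λ t → g x * c + t) (∑-*ʳ xs g c)) (sym (*-distribʳ-+ c (g x) (∑ xs g)))

  ∑-const : ∀ (xs : List X) c → ∑[ x ∈ xs ] c ≡ length xs * c
  ∑-const []       c = refl
  ∑-const (x ∷ xs) c = cong (λ t → c + t) (∑-const xs c)

  ∑-≤-length* : ∀ {xs} {g : X → ℕ} {c} → All (λ x → g x ≤ c) xs → ∑ xs g ≤ length xs * c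
  ∑-≤-length* All.[]           = z≤n
  ∑-≤-length* (gx≤c All.∷ g≤c) = +-mono-≤ gx≤c (∑-≤-length* g≤c)

  length-filter≡∑𝟙 : ∀ {p} {P : X → Set p} (P? : ∀ x → Dec (P x)) xs → length (filter P? xs) ≡ ∑[ x ∈ xs ] 𝟙 (P? x)
  length-filter≡∑𝟙 P? []       = refl
  length-filter≡∑𝟙 P? (x ∷ xs) with P? x
  ... | yes _ = cong suc (length-filter≡∑𝟙 P? xs)
  ... | no  _ = length-filter≡∑𝟙 P? xs

  ∑-𝟙*-none : ∀ {p} {P : X → Set p} (P? : ∀ x → Dec (P x)) (g : X → ℕ) {xs} →
              All (¬_ ∘ P) xs → ∑[ x ∈ xs ] 𝟙 (P? x) * g x ≡ 0
  ∑-𝟙*-none P? g All.[]                      = refl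
  ∑-𝟙*-none P? g {x ∷ _} (¬px All.∷ ¬pxs) with P? x
  ... | yes px = contradiction px ¬px
  ... | no  _  = ∑-𝟙*-none P? g ¬pxs

∑-swap : ∀ {a b} {X : Set a} {Y : Set b} (xs : List X) (ys : List Y) (g : X → Y → ℕ) →
         ∑[ x ∈ xs ] ∑ ys (g x) ≡ ∑[ y ∈ ys ] ∑[ x ∈ xs ] g x y
∑-swap []       ys g = sym (trans (∑-const ys 0) (*-zeroʳ (length ys)))
∑-swap (x ∷ xs) ys g = trans (cong (λ t → ∑ ys (g x) + t) (∑-swap xs ys g))
                             (sym (∑-+ ys (g x) (λ y → ∑[ x′ ∈ xs ] g x′ y)))

2ab≤a²+b²-ordered : ∀ {a b} → a ≤ b → 2 * (a * b) ≤ a * a + b * b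
2ab≤a²+b²-ordered {a} a≤b with d , refl ← m≤n⇒∃[o]m+o≡n a≤b = begin
  2 * (a * (a + d))         ≤⟨ m≤m+n _ (d * d) ⟩
  2 * (a * (a + d)) + d * d ≡⟨ solve (a ∷ d ∷ []) ⟩
  a * a + (a + d) * (a + d) ∎
  where open ≤-Reasoning

2ab≤a²+b² : ∀ a b → 2 * (a * b) ≤ a * a + b * b
2ab≤a²+b² a b with ≤-total a b
... | inj₁ a≤b = 2ab≤a²+b²-ordered a≤b
... | inj₂ b≤a = subst₂ _≤_ (cong (2 *_) (*-comm b a)) (+-comm (b * b) (a * a)) (2ab≤a²+b²-ordered b≤a)

cross-term-step : ∀ c a T k S → 2 * (c * T) ≤ k * (c * c) + S →
                  2 * (c * (a + T)) ≤ suc k * (c * c) + (a * a + S)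
cross-term-step c a T k S hyp = begin
  2 * (c * (a + T))                          ≡⟨ solve (c ∷ a ∷ T ∷ []) ⟩
  2 * (c * a) + 2 * (c * T)                  ≤⟨ +-mono-≤ (2ab≤a²+b² c a) hyp ⟩
  (c * c + a * a) + (k * (c * c) + S)        ≡⟨ solve (c ∷ a ∷ k ∷ S ∷ []) ⟩
  suc k * (c * c) + (a * a + S)              ∎
  where open ≤-Reasoning

cauchy-schwarz-step : ∀ a T k S → 2 * (a * T) ≤ k * (a * a) + S → T * T ≤ k * S →
                      (a + T) * (a + T) ≤ suc k * (a * a + S)
cauchy-schwarz-step a T k S cross T²≤kS = begin
  (a + T) * (a + T)                 ≡⟨ solve (a ∷ T ∷ []) ⟩
  a * a + 2 * (a * T) + T * T       ≤⟨ +-mono-≤ (+-monoʳ-≤ (a * a) cross) T²≤kS ⟩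
  a * a + (k * (a * a) + S) + k * S ≡⟨ solve (a ∷ k ∷ S ∷ []) ⟩
  suc k * (a * a + S)               ∎
  where open ≤-Reasoning

module _ {ℓ} {X : Set ℓ} where

  ∑-cross≤ : ∀ c xs (g : X → ℕ) → 2 * (c * ∑ xs g) ≤ length xs * (c * c) + (∑[ x ∈ xs ] g x * g x)
  ∑-cross≤ c []       g = ≤-reflexive (cong (2 *_) (*-zeroʳ c))
  ∑-cross≤ c (x ∷ xs) g = cross-term-step c (g x) (∑ xs g) (length xs) _ (∑-cross≤ c xs g)

  ∑-cauchy-schwarz : ∀ xs (g : X → ℕ) → ∑ xs g * ∑ xs g ≤ length xs * (∑[ x ∈ xs ] g x * g x)
  ∑-cauchy-schwarz []       g = z≤n
  ∑-cauchy-schwarz (x ∷ xs) g = cauchy-schwarz-step (g x) (∑ xs g) (length xs) _ (∑-cross≤ (g x) xs g) (∑-cauchy-schwarz xs g)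

module Counting {c ℓ} (S : Setoid c ℓ) (_≟_ : Decidable (Setoid._≈_ S)) where
  open Setoid S renaming (Carrier to C; refl to ≈-refl; sym to ≈-sym; trans to ≈-trans)
  open UniqueS S using (Unique)

  _without_ : List C → C → List C
  xs without z = filter (λ w → ¬? (z ≟ w)) xs

  ∑-without : ∀ {z xs} (g : C → ℕ) → g Preserves _≈_ ⟶ _≡_ → Unique xs → Any (z ≈_) xs → ∑ xs g ≡ g z + ∑ (xs without z) g
  ∑-without {z} {w ∷ ws} g g-cong (w≉ws AllPairs.∷ _) (here z≈w) with z ≟ w
  ... | yes _   = cong₂ _+_ (g-cong (≈-sym z≈w)) (cong (λ ys → ∑ ys g) (sym (filter-all _ z≉ws)))
    where
    z≉ws : All (λ v → ¬ z ≈ v) ws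
    z≉ws = All.map (λ w≉v z≈v → w≉v (≈-trans (≈-sym z≈w) z≈v)) w≉ws
  ... | no z≉w = contradiction z≈w z≉w
  ∑-without {z} {w ∷ ws} g g-cong (w≉ws AllPairs.∷ u) (there z∈ws) with z ≟ w
  ... | yes z≈w = contradiction (Any.map (≈-trans (≈-sym z≈w)) z∈ws) (All¬⇒¬Any w≉ws)
  ... | no _    = trans (cong (λ t → g w + t) (∑-without g g-cong u z∈ws)) (+-left-comm (g w) (g z) _)

  length-without : ∀ {z xs} → Unique xs → Any (z ≈_) xs → length xs ≡ suc (length (xs without z))
  length-without {z} {xs} u z∈xs = begin
    length xs                    ≡⟨ sym (∑-1 xs) ⟩
    ∑[ x ∈ xs ] 1                ≡⟨ ∑-without (λ _ → 1) (λ _ → refl) u z∈xs ⟩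
    suc (∑[ x ∈ xs without z ] 1) ≡⟨ cong suc (∑-1 (xs without z)) ⟩
    suc (length (xs without z))  ∎
    where
    open ≡-Reasoning
    ∑-1 : ∀ ys → ∑[ y ∈ ys ] 1 ≡ length ys
    ∑-1 ys = trans (∑-const ys 1) (*-identityʳ (length ys))

  ∑-select : ∀ {z xs} (g : C → ℕ) → g Preserves _≈_ ⟶ _≡_ → Unique xs → Any (z ≈_) xs → ∑[ w ∈ xs ] 𝟙 (z ≟ w) * g w ≡ g z
  ∑-select {z} {xs} g g-cong u z∈xs = begin
    ∑ xs δg                      ≡⟨ ∑-without δg δg-cong u z∈xs ⟩
    δg z + ∑ (xs without z) δg   ≡⟨ cong₂ _+_ δg-z (∑-𝟙*-none (z ≟_) g (all-filter (λ w → ¬? (z ≟ w)) xs)) ⟩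
    g z + 0                      ≡⟨ +-identityʳ (g z) ⟩
    g z                          ∎
    where
    open ≡-Reasoning
    δg : C → ℕ
    δg w = 𝟙 (z ≟ w) * g w
    δg-cong : δg Preserves _≈_ ⟶ _≡_
    δg-cong u≈v = cong₂ _*_ (𝟙-cong (λ z≈u → ≈-trans z≈u u≈v) (λ z≈v → ≈-trans z≈v (≈-sym u≈v)) (z ≟ _) (z ≟ _))
                              (g-cong u≈v)
    δg-z : δg z ≡ g z
    δg-z with z ≟ z
    ... | yes _   = +-identityʳ (g z)
    ... | no z≉z = contradiction ≈-refl z≉z

  ∑-𝟙≈ : ∀ {z xs} → Unique xs → Any (z ≈_) xs → ∑[ w ∈ xs ] 𝟙 (z ≟ w) ≡ 1
  ∑-𝟙≈ {z} {xs} u z∈xs =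
    trans (∑-cong xs (λ w → sym (*-identityʳ (𝟙 (z ≟ w))))) (∑-select (λ _ → 1) (λ _ → refl) u z∈xs)

  ∑-reindex : ∀ {xs} → Unique xs → (∀ x → Any (x ≈_) xs) →
              (h h⁻¹ : C → C) → (∀ {x y} → h x ≈ y → h⁻¹ y ≈ x) → (∀ {x y} → h⁻¹ y ≈ x → h x ≈ y) →
              (g : C → ℕ) → g Preserves _≈_ ⟶ _≡_ → ∑[ x ∈ xs ] g (h x) ≡ ∑ xs g
  ∑-reindex {xs} u complete h h⁻¹ h⇒h⁻¹ h⁻¹⇒h g g-cong = begin
    ∑[ x ∈ xs ] g (h x)                          ≡⟨ ∑-cong xs (λ x → sym (∑-select g g-cong u (complete (h x)))) ⟩
    ∑[ x ∈ xs ] ∑[ y ∈ xs ] 𝟙 (h x ≟ y) * g y    ≡⟨ ∑-swap xs xs (λ x y → 𝟙 (h x ≟ y) * g y) ⟩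
    ∑[ y ∈ xs ] ∑[ x ∈ xs ] 𝟙 (h x ≟ y) * g y    ≡⟨ ∑-cong xs (λ y → ∑-*ʳ xs (λ x → 𝟙 (h x ≟ y)) (g y)) ⟩
    ∑[ y ∈ xs ] (∑[ x ∈ xs ] 𝟙 (h x ≟ y)) * g y  ≡⟨ ∑-cong xs (λ y → cong (_* g y) (preimage-count y)) ⟩
    ∑[ y ∈ xs ] 1 * g y                          ≡⟨ ∑-cong xs (λ y → *-identityˡ (g y)) ⟩
    ∑ xs g                                       ∎
    where
    open ≡-Reasoning
    preimage-count : ∀ y → ∑[ x ∈ xs ] 𝟙 (h x ≟ y) ≡ 1
    preimage-count y = trans (∑-cong xs (λ x → 𝟙-cong h⇒h⁻¹ h⁻¹⇒h (h x ≟ y) (h⁻¹ y ≟ x)))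
                             (∑-𝟙≈ u (complete (h⁻¹ y)))

module FiberCounting {a ℓa b ℓb} (A : FiniteAbelianGroup a ℓa) (B : FiniteAbelianGroup b ℓb)
                     (f : FiniteAbelianGroup.Carrier A → FiniteAbelianGroup.Carrier B) (f-cong : Congruent A B f) where
  private
    module A  = FiniteAbelianGroup A
    module B  = FiniteAbelianGroup B
    module CA = Counting A.setoid A._≟_
    module CB = Counting B.setoid B._≟_
    module G  = GroupProperties A.group

  r : B.Carrier → ℕ
  r = fiber A B f

  Λ : A.Carrier → ℕ
  Λ = lambdaOf A B f

  r≡∑𝟙 : ∀ c → r c ≡ ∑[ x ∈ A.elems ] 𝟙 (f x B.≟ c)
  r≡∑𝟙 c = length-filter≡∑𝟙 (λ x → f x B.≟ c) A.elems

  Λ≡∑𝟙 : ∀ α → Λ α ≡ ∑[ x ∈ A.elems ] 𝟙 (f (x A.∙ α) B.≟ f x)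
  Λ≡∑𝟙 α = length-filter≡∑𝟙 (λ x → f (x A.∙ α) B.≟ f x) A.elems

  r-cong : ∀ {c c′} → c B.≈ c′ → r c ≡ r c′
  r-cong c≈c′ = cong length (filter-≐ _ _ ((λ e → B.trans e c≈c′) , (λ e → B.trans e (B.sym c≈c′))) A.elems)

  Λ-cong : ∀ {α α′} → α A.≈ α′ → Λ α ≡ Λ α′
  Λ-cong α≈α′ = cong length (filter-≐ _ _ ((λ e → B.trans (f-cong (A.∙-congˡ (A.sym α≈α′))) e) ,
                                            (λ e → B.trans (f-cong (A.∙-congˡ α≈α′)) e)) A.elems)

  ∑-r : ∑ B.elems r ≡ A.order
  ∑-r = begin
    ∑ B.elems r                                        ≡⟨ ∑-cong B.elems r≡∑𝟙 ⟩
    ∑[ c ∈ B.elems ] ∑[ x ∈ A.elems ] 𝟙 (f x B.≟ c)   ≡⟨ sym (∑-swap A.elems B.elems (λ x c → 𝟙 (f x B.≟ c))) ⟩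
    ∑[ x ∈ A.elems ] ∑[ c ∈ B.elems ] 𝟙 (f x B.≟ c)   ≡⟨ ∑-cong A.elems (λ x → CB.∑-𝟙≈ B.unique (B.complete (f x))) ⟩
    ∑[ x ∈ A.elems ] 1                                 ≡⟨ ∑-const A.elems 1 ⟩
    A.order * 1                                        ≡⟨ *-identityʳ A.order ⟩
    A.order                                            ∎
    where open ≡-Reasoning

  ∑-translate : ∀ x (g : A.Carrier → ℕ) → g Preserves A._≈_ ⟶ _≡_ → ∑[ α ∈ A.elems ] g (x A.∙ α) ≡ ∑ A.elems g
  ∑-translate x = CA.∑-reindex A.unique A.complete (x A.∙_) ((x A.⁻¹) A.∙_)
    (λ {α} {y} x∙α≈y → A.sym (G.y≈x\\z x α y x∙α≈y))
    (λ {α} {y} x⁻¹∙y≈α → A.trans (A.∙-congˡ (A.sym x⁻¹∙y≈α)) (G.\\-leftDividesˡ x y))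

  ∑-r² : ∑[ c ∈ B.elems ] r c * r c ≡ ∑ A.elems Λ
  ∑-r² = begin
    ∑[ c ∈ B.elems ] r c * r c                                   ≡⟨ ∑-cong B.elems (λ c → cong (_* r c) (r≡∑𝟙 c)) ⟩
    ∑[ c ∈ B.elems ] (∑[ x ∈ A.elems ] 𝟙 (f x B.≟ c)) * r c      ≡⟨ ∑-cong B.elems (λ c → sym (∑-*ʳ A.elems (λ x → 𝟙 (f x B.≟ c)) (r c))) ⟩
    ∑[ c ∈ B.elems ] ∑[ x ∈ A.elems ] 𝟙 (f x B.≟ c) * r c        ≡⟨ sym (∑-swap A.elems B.elems (λ x c → 𝟙 (f x B.≟ c) * r c)) ⟩
    ∑[ x ∈ A.elems ] ∑[ c ∈ B.elems ] 𝟙 (f x B.≟ c) * r c        ≡⟨ ∑-cong A.elems (λ x → CB.∑-select r r-cong B.unique (B.complete (f x))) ⟩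
    ∑[ x ∈ A.elems ] r (f x)                                     ≡⟨ ∑-cong A.elems (r≡∑𝟙 ∘ f) ⟩
    ∑[ x ∈ A.elems ] ∑[ x′ ∈ A.elems ] 𝟙 (f x′ B.≟ f x)          ≡⟨ ∑-cong A.elems (λ x → sym (∑-translate x (λ x′ → 𝟙 (f x′ B.≟ f x)) (collides x))) ⟩
    ∑[ x ∈ A.elems ] ∑[ α ∈ A.elems ] 𝟙 (f (x A.∙ α) B.≟ f x)    ≡⟨ ∑-swap A.elems A.elems (λ x α → 𝟙 (f (x A.∙ α) B.≟ f x)) ⟩
    ∑[ α ∈ A.elems ] ∑[ x ∈ A.elems ] 𝟙 (f (x A.∙ α) B.≟ f x)    ≡⟨ sym (∑-cong A.elems Λ≡∑𝟙) ⟩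
    ∑ A.elems Λ                                                  ∎
    where
    open ≡-Reasoning
    collides : ∀ x {u v} → u A.≈ v → 𝟙 (f u B.≟ f x) ≡ 𝟙 (f v B.≟ f x)
    collides x u≈v = 𝟙-cong (B.trans (f-cong (A.sym u≈v))) (B.trans (f-cong u≈v)) (f _ B.≟ f x) (f _ B.≟ f x)

  ∑-Λ≤ : ∀ {lam} → (∀ α → ¬ (α A.≈ A.ε) → Λ α ≤ lam) → ∑ A.elems Λ ≤ A.order + length (A.elems CA.without A.ε) * lam
  ∑-Λ≤ {lam} Λ≤lam = begin
    ∑ A.elems Λ                                  ≡⟨ CA.∑-without Λ Λ-cong A.unique (A.complete A.ε) ⟩
    Λ A.ε + ∑ (A.elems CA.without A.ε) Λ         ≤⟨ +-mono-≤ (length-filter _ A.elems) (∑-≤-length* Λ≤lam-off-ε) ⟩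
    A.order + length (A.elems CA.without A.ε) * lam ∎
    where
    open ≤-Reasoning
    Λ≤lam-off-ε : All (λ α → Λ α ≤ lam) (A.elems CA.without A.ε)
    Λ≤lam-off-ε = All.map (λ ε≉α → Λ≤lam _ (ε≉α ∘ A.sym)) (all-filter (λ α → ¬? (A.ε A.≟ α)) A.elems)

*-nonNeg : ∀ {i j} → 0ℤ ℤ.≤ i → 0ℤ ℤ.≤ j → 0ℤ ℤ.≤ i ℤ.* j
*-nonNeg {+ i} {+ j} _ _ = subst (0ℤ ℤ.≤_) (ℤₚ.pos-* i j) (ℤ.+≤+ z≤n)

Δ-gap : ∀ r T k S l u → let n = r ℤ.+ T; m = 1ℤ ℤ.+ k; d = m ℤ.* r ℤ.- n in
        (n ℤ.+ l ℤ.* n ℤ.- l) ℤ.* m ℤ.* m ℤ.- (n ℤ.* n ℤ.+ n ℤ.+ u ℤ.* n ℤ.- u) ℤ.* m ℤ.+ n ℤ.* n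
        ≡ d ℤ.* d ℤ.+ m ℤ.* (k ℤ.* (n ℤ.+ n ℤ.* l ℤ.- (r ℤ.* r ℤ.+ S ℤ.+ l)) ℤ.+ (l ℤ.- u) ℤ.* (n ℤ.- 1ℤ) ℤ.+ (k ℤ.* S ℤ.- T ℤ.* T))
Δ-gap = ℤSolver.solve-∀

-- The right-hand side is Δ at integer arguments, so that square≤Δ can use it definitionally.
square≤Δℤ : ∀ r T k S l u → let n = r ℤ.+ T; m = 1ℤ ℤ.+ k; d = m ℤ.* r ℤ.- n in
            0ℤ ℤ.≤ k → T ℤ.* T ℤ.≤ k ℤ.* S → r ℤ.* r ℤ.+ S ℤ.+ l ℤ.≤ n ℤ.+ n ℤ.* l → u ℤ.≤ l → 1ℤ ℤ.≤ n →
            d ℤ.* d ℤ.≤ (n ℤ.+ l ℤ.* n ℤ.- l) ℤ.* m ℤ.* m ℤ.- (n ℤ.* n ℤ.+ n ℤ.+ u ℤ.* n ℤ.- u) ℤ.* m ℤ.+ n ℤ.* n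
square≤Δℤ r T k S l u 0≤k T²≤kS moment u≤l 1≤n =
  subst (d ℤ.* d ℤ.≤_) (sym (Δ-gap r T k S l u)) (ℤₚ.i≤i+j (d ℤ.* d) _ ⦃ ℤ.nonNegative gap≥0 ⦄)
  where
  d : ℤ
  d = (1ℤ ℤ.+ k) ℤ.* r ℤ.- (r ℤ.+ T)
  gap≥0 : 0ℤ ℤ.≤ (1ℤ ℤ.+ k) ℤ.* (k ℤ.* ((r ℤ.+ T) ℤ.+ (r ℤ.+ T) ℤ.* l ℤ.- (r ℤ.* r ℤ.+ S ℤ.+ l))
                                 ℤ.+ (l ℤ.- u) ℤ.* ((r ℤ.+ T) ℤ.- 1ℤ) ℤ.+ (k ℤ.* S ℤ.- T ℤ.* T))
  gap≥0 = *-nonNeg (ℤₚ.+-mono-≤ (ℤ.+≤+ z≤n) 0≤k)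
            (ℤₚ.+-mono-≤ (ℤₚ.+-mono-≤ (*-nonNeg 0≤k (ℤₚ.i≤j⇒0≤j-i moment))
                                      (*-nonNeg (ℤₚ.i≤j⇒0≤j-i u≤l) (ℤₚ.i≤j⇒0≤j-i 1≤n)))
                         (ℤₚ.i≤j⇒0≤j-i T²≤kS))

square≤Δ : ∀ {n m r T k S N lam mu} → n ≡ r + T → n ≡ suc N → m ≡ suc k →
           T * T ≤ k * S → r * r + S ≤ n + N * lam → mu ≤ lam →
           let d = (+ m) ℤ.* (+ r) ℤ.- (+ n) in d ℤ.* d ℤ.≤ Δ n m lam mu
square≤Δ {r = r} {T} {k} {S} {N} {lam} {mu} refl n≡1+N refl T²≤kS moment mu≤lam =
  square≤Δℤ (+ r) (+ T) (+ k) (+ S) (+ lam) (+ mu) (ℤ.+≤+ z≤n)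
    (subst₂ ℤ._≤_ (ℤₚ.pos-* T T) (ℤₚ.pos-* k S) (ℤ.+≤+ T²≤kS))
    (subst₂ ℤ._≤_ (cong (λ t → t ℤ.+ (+ S) ℤ.+ (+ lam)) (ℤₚ.pos-* r r)) (cong (λ t → (+ n) ℤ.+ t) (ℤₚ.pos-* n lam))
            (ℤ.+≤+ moment′))
    (ℤ.+≤+ mu≤lam)
    (ℤ.+≤+ (subst (1 ≤_) (sym n≡1+N) (s≤s z≤n)))
  where
  n = r + T
  moment′ : r * r + S + lam ≤ n + n * lam
  moment′ = begin
    r * r + S + lam      ≤⟨ +-monoˡ-≤ lam moment ⟩
    n + N * lam + lam    ≡⟨ +-assoc n (N * lam) lam ⟩
    n + (N * lam + lam)  ≡⟨ cong (λ t → n + t) (+-comm (N * lam) lam) ⟩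
    n + suc N * lam      ≡⟨ cong (λ t → n + t * lam) (sym n≡1+N) ⟩
    n + n * lam          ∎
    where open ≤-Reasoning

lemma3 : ∀ {a ℓa b ℓb} (A : FiniteAbelianGroup a ℓa) (B : FiniteAbelianGroup b ℓb)
           (f : FiniteAbelianGroup.Carrier A → FiniteAbelianGroup.Carrier B)
           → Congruent A B f → Surjective A B f
           → (lam mu : ℕ) → IsMaxS A B f lam → IsMinS A B f mu
           → ∀ y →
             let n = FiniteAbelianGroup.order A
                 m = FiniteAbelianGroup.order B
                 d = (+ m) ℤ.* (+ fiber A B f y) ℤ.- (+ n)
             in d ℤ.* d ℤ.≤ Δ n m lam mu
lemma3 A B f f-cong _ lam mu (_ , Λ≤lam) ((α , α≉ε , Λα≡mu) , _) y =
  square≤Δ n≡r+T (CA.length-without A.unique (A.complete A.ε)) (CB.length-without B.unique (B.complete y))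
           (∑-cauchy-schwarz others r) moment (subst (_≤ lam) Λα≡mu (Λ≤lam α α≉ε))
  where
  open FiberCounting A B f f-cong
  module A  = FiniteAbelianGroup A
  module B  = FiniteAbelianGroup B
  module CA = Counting A.setoid A._≟_
  module CB = Counting B.setoid B._≟_

  others : List B.Carrier
  others = B.elems CB.without y

  split-off-y : ∀ g → g Preserves B._≈_ ⟶ _≡_ → ∑ B.elems g ≡ g y + ∑ others g
  split-off-y g g-cong = CB.∑-without g g-cong B.unique (B.complete y)

  n≡r+T : A.order ≡ r y + ∑ others r
  n≡r+T = trans (sym ∑-r) (split-off-y r r-cong)

  moment : r y * r y + (∑[ c ∈ others ] r c * r c) ≤ A.order + length (A.elems CA.without A.ε) * lam
  moment = subst (_≤ A.order + length (A.elems CA.without A.ε) * lam)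
                 (trans (sym ∑-r²) (split-off-y (λ c → r c * r c) (λ e → cong₂ _*_ (r-cong e) (r-cong e))))
                 (∑-Λ≤ Λ≤lam)
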